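{- Let $G$ be a graph with maximum degree at most $3$ and let $L$ be an assignment of lists of size $8$ to the vertices of $G$. Suppose $G^2$ has a partial proper coloring from $L$. Suppose that vertices $u$ and $v$ are uncolored, are adjacent in $G^2$, and satisfy $\mathrm{excess}(u)\ge 1$ and $\mathrm{excess}(v)\ge 2$. If the uncolored vertices can be ordered so that each uncolored vertex other than $u$ and $v$ is succeeded in the order by at least $2$ vertices adjacent to it in $G^2$, then the partial coloring can be extended to a proper coloring of all of $G^2$ from $L$.
   Context: All graphs are finite and simple. The square $G^2$ of $G$ has vertex set $V(G)$, with two vertices adjacent if their distance in $G$ is at most $2$. A partial proper coloring from $L$ assigns to some vertices $w$ a color in $L(w)$ such that no two vertices adjacent in $G^2$ receive the same color; other vertices are uncolored. For an uncolored vertex $w$, the colors available at $w$ are the colors of $L(w)$ not used on any colored neighbor of $w$ in $G^2$, and $\mathrm{excess}(w)=1+(\text{number of colors available at } w)-(\text{number of uncolored neighbors of } w \text{ in } G^2)$. -}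

module Defs where

open import Data.Nat using (ℕ; _≤_; _≡ᵇ_)
open import Data.Integer using (ℤ; +_; _-_; _+_)
open import Data.Bool using (Bool; true; false; _∧_; _∨_; not)
open import Data.Fin using (Fin; _≟_)
open import Data.List using (List; length; filterᵇ; allFin)
open import Data.Bool.ListAction using (any)
open import Data.Product using (_×_)
open import Data.List.Relation.Unary.Unique.Propositional using (Unique)
open import Data.List.Membership.Propositional using (_∈_)
open import Data.Maybe using (Maybe; just; nothing)
open import Relation.Nullary.Decidable using (⌊_⌋)
open import Relation.Binary.PropositionalEquality using (_≡_)
open import Data.Empty using (⊥)

record Graph (n : ℕ) : Set where
  field
    adj    : Fin n → Fin n → Bool
    sym    : ∀ x y → adj x y ≡ adj y x
    irrefl : ∀ x → adj x x ≡ false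
open Graph public

module _ {n : ℕ} (G : Graph n) where

  degree : Fin n → ℕ
  degree x = length (filterᵇ (adj G x) (allFin n))

  MaxDegreeAtMost : ℕ → Set
  MaxDegreeAtMost d = ∀ x → degree x ≤ d

  sqAdj : Fin n → Fin n → Bool
  sqAdj x y = not ⌊ x ≟ y ⌋ ∧ (adj G x y ∨ any (λ z → adj G x z ∧ adj G z y) (allFin n))

  -- partial colorings: nothing = uncolored
  PartialColoring : Set
  PartialColoring = Fin n → Maybe ℕ

  IsPartialProperColoring : (Fin n → List ℕ) → PartialColoring → Set
  IsPartialProperColoring L f =
    (∀ w a → f w ≡ just a → a ∈ L w) ×
    (∀ w x a → sqAdj w x ≡ true → f w ≡ just a → f x ≡ just a → ⊥)

  isColor : Maybe ℕ → ℕ → Bool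
  isColor (just a) k = a ≡ᵇ k
  isColor nothing  k = false

  uncoloredᵇ : PartialColoring → Fin n → Bool
  uncoloredᵇ f x with f x
  ... | just _  = false
  ... | nothing = true

  usedNear : PartialColoring → Fin n → ℕ → Bool
  usedNear f w k = any (λ x → sqAdj w x ∧ isColor (f x) k) (allFin n)

  available : (Fin n → List ℕ) → PartialColoring → Fin n → ℕ
  available L f w = length (filterᵇ (λ k → not (usedNear f w k)) (L w))

  uncoloredNbrs : PartialColoring → Fin n → ℕ
  uncoloredNbrs f w = length (filterᵇ (λ x → sqAdj w x ∧ uncoloredᵇ f x) (allFin n))

  excess : (Fin n → List ℕ) → PartialColoring → Fin n → ℤ
  excess L f w = (+ 1 + + available L f w) - + uncoloredNbrs f w

  IsProperColoring : (Fin n → List ℕ) → (Fin n → ℕ) → Set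
  IsProperColoring L c =
    (∀ w → c w ∈ L w) ×
    (∀ w x → sqAdj w x ≡ true → c w ≡ c x → ⊥)

  IsOrderingOfUncolored : PartialColoring → List (Fin n) → Set
  IsOrderingOfUncolored f σ =
    Unique σ × (∀ w → (w ∈ σ → f w ≡ nothing) × (f w ≡ nothing → w ∈ σ))

-- Extending a partial colouring never lowers the excess
-- of a vertex: each newly coloured G²-neighbour of w blocks at most one colour of L w, and it is also
-- one uncoloured neighbour fewer. In the empty colouring every vertex has excess ≥ 8 + 1 − 9 = 0, as
-- G² has maximum degree at most 3 + 3·2 = 9. So colouring the uncoloured vertices other than u and v
-- greedily in the given order never gets stuck: the current vertex still has excess ≥ 0 and at least
-- two uncoloured G²-neighbours, hence an available colour. Afterwards u still has excess ≥ 1 and the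
-- uncoloured neighbour v, so it can be coloured, and then v, with excess ≥ 2, can be coloured last.

module Submission where

open import Defs hiding (sym)
open import Data.Nat using (ℕ; suc; pred; _+_; _*_; _≤_; _<_; z≤n; s≤s)
open import Data.Nat.Properties
  using (≤-trans; ≤-reflexive; +-assoc; +-mono-≤; +-monoʳ-≤; +-cancelʳ-≤; m≤m+n; *-monoˡ-≤; suc[m]≤n⇒m≤pred[n]; ≡ᵇ⇒≡; ≡⇒≡ᵇ)
open import Data.Integer using (+_) renaming (_≤_ to _≤ℤ_)
import Data.Integer as ℤ
import Data.Integer.Properties as ℤP
open import Algebra.Bundles using (AbelianGroup)
open import Algebra.Properties.Group (AbelianGroup.group ℤP.+-0-abelianGroup) using (//-rightDividesˡ)
open import Data.Bool using (true; false; T; not; _∧_; _∨_)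
open import Data.Bool.Properties using (T-≡; T-∧; T-∨; ∧-comm)
open import Data.Fin using (Fin; _≟_)
open import Data.List using (List; []; _∷_; _++_; length; filterᵇ; allFin; map; concatMap)
open import Data.List.Properties using (length-++; length-map; length-removeAt′; map-cong; filter-notAll; filter-all; filter-some)
open import Data.List.Relation.Unary.Any using (here; there; _─_; satisfied)
open import Data.List.Relation.Unary.Any.Properties using (any⁺; any⁻)
open import Data.List.Relation.Unary.All as All using (All; []; _∷_)
open import Data.List.Relation.Unary.Unique.Propositional using (Unique; []; _∷_)
import Data.List.Relation.Unary.Unique.Propositional.Properties as Unique
open import Data.List.Membership.Propositional using (_∈_; lose)
open import Data.List.Membership.Propositional.Properties
  using (∈-filter⁺; ∈-filter⁻; ∈-allFin; ∈-map⁺; ∈-++⁺ˡ; ∈-++⁺ʳ; ∈-++⁻; ∈-concat⁺′)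
open import Data.List.Relation.Binary.Subset.Propositional using (_⊆_)
open import Data.Bool.ListAction using (or)
open import Data.Maybe using (just; nothing; fromMaybe)
open import Data.Maybe.Properties using (just-injective)
open import Data.List.Relation.Binary.Disjoint.Propositional using (Disjoint)
open import Data.Product using (Σ; ∃; _×_; _,_; proj₁; proj₂)
open import Data.Sum using (_⊎_; inj₁; inj₂; [_,_])
open import Data.Empty using (⊥; ⊥-elim)
open import Function using (_∘_; const; Equivalence; mk⇔)
open import Data.Vec.Functional using (updateAt)
open import Data.Vec.Functional.Properties using (updateAt-updates; updateAt-minimal)
open import Relation.Nullary using (¬_; yes; no)
open import Relation.Unary using (Decidable)
open import Relation.Nullary.Decidable using (⌊_⌋; _⊎-dec_; T?; toWitnessFalse; fromWitnessFalse; does-⇔; isYes≗does)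
open import Relation.Binary.PropositionalEquality
  using (_≡_; _≢_; refl; sym; trans; cong; cong₂; subst)

T-∧⁻ : ∀ a {b} → T (a ∧ b) → T a × T b
T-∧⁻ a = Equivalence.to (T-∧ {a})

T-∨⁻ : ∀ a {b} → T (a ∨ b) → T a ⊎ T b
T-∨⁻ a = Equivalence.to (T-∨ {a})

T-not⇒¬T : ∀ {b} → T (not b) → ¬ T b
T-not⇒¬T {false} _ ()

¬T⇒T-not : ∀ {b} → ¬ T b → T (not b)
¬T⇒T-not {false} _ = _
¬T⇒T-not {true} ¬t = ¬t _

module _ {A : Set} where

  ∈-─ : ∀ {x y : A} {ys} (x∈ys : x ∈ ys) → y ∈ ys → y ≢ x → y ∈ (ys ─ x∈ys)
  ∈-─ (here refl) (here refl) y≢x = ⊥-elim (y≢x refl)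
  ∈-─ (here refl) (there y∈ys) y≢x = y∈ys
  ∈-─ (there x∈ys) (here refl) y≢x = here refl
  ∈-─ (there x∈ys) (there y∈ys) y≢x = there (∈-─ x∈ys y∈ys y≢x)

  length-mono-⊆ : ∀ {xs ys : List A} → Unique xs → xs ⊆ ys → length xs ≤ length ys
  length-mono-⊆ {[]} _ _ = z≤n
  length-mono-⊆ {x ∷ xs} {ys} (x∉xs ∷ xs!) xs⊆ys = begin
    suc (length xs)             ≤⟨ s≤s (length-mono-⊆ xs! xs⊆ys─x) ⟩
    suc (length (ys ─ x∈ys))    ≡⟨ length-removeAt′ ys _ ⟨
    length ys                   ∎
    where
    open Data.Nat.Properties.≤-Reasoning
    x∈ys : x ∈ ys
    x∈ys = xs⊆ys (here refl)
    xs⊆ys─x : xs ⊆ (ys ─ x∈ys)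
    xs⊆ys─x y∈xs = ∈-─ x∈ys (xs⊆ys (there y∈xs)) (λ y≡x → All.lookup x∉xs y∈xs (sym y≡x))

  nonEmpty⇒∈ : ∀ {xs : List A} → 0 < length xs → ∃ (_∈ xs)
  nonEmpty⇒∈ {x ∷ _} _ = x , here refl

  length-concatMap≤ : ∀ {B : Set} (g : A → List B) {k} (xs : List A) →
    (∀ {x} → x ∈ xs → length (g x) ≤ k) → length (concatMap g xs) ≤ length xs * k
  length-concatMap≤ g [] _ = z≤n
  length-concatMap≤ g (x ∷ xs) bound = begin
    length (g x ++ concatMap g xs)          ≡⟨ length-++ (g x) ⟩
    length (g x) + length (concatMap g xs)  ≤⟨ +-mono-≤ (bound (here refl)) (length-concatMap≤ g xs (bound ∘ there)) ⟩
    _                                       ∎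
    where open Data.Nat.Properties.≤-Reasoning

module PartialColorings {n : ℕ} (G : Graph n) where

  sqAdj⇒≢ : ∀ {x y} → T (sqAdj G x y) → x ≢ y
  sqAdj⇒≢ {x} {y} xy = toWitnessFalse (proj₁ (T-∧⁻ (not ⌊ x ≟ y ⌋) xy))

  sqAdj-sym : ∀ x y → sqAdj G x y ≡ sqAdj G y x
  sqAdj-sym x y = cong₂ (λ b c → not b ∧ c)
    ≟-sym
    (cong₂ _∨_ (Graph.sym G x y) (cong or (map-cong twoStep-sym (allFin n))))
    where
    ≟-sym : ⌊ x ≟ y ⌋ ≡ ⌊ y ≟ x ⌋
    ≟-sym = trans (isYes≗does (x ≟ y)) (trans (does-⇔ (mk⇔ sym sym) (x ≟ y) (y ≟ x)) (sym (isYes≗does (y ≟ x))))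
    twoStep-sym : ∀ z → adj G x z ∧ adj G z y ≡ adj G y z ∧ adj G z x
    twoStep-sym z = trans (cong₂ _∧_ (Graph.sym G x z) (Graph.sym G z y)) (∧-comm (adj G z x) (adj G y z))

  neighbours : Fin n → List (Fin n)
  neighbours x = filterᵇ (adj G x) (allFin n)

  secondNeighbours : Fin n → List (Fin n)
  secondNeighbours w = concatMap (λ z → filterᵇ (λ y → not ⌊ y ≟ w ⌋) (neighbours z)) (neighbours w)

  sqAdj⇒∈ : ∀ {w y} → T (sqAdj G w y) → y ∈ neighbours w ++ secondNeighbours w
  sqAdj⇒∈ {w} {y} wy with T-∧⁻ (not ⌊ w ≟ y ⌋) wy
  ... | w≢y , near with T-∨⁻ (adj G w y) near
  ...   | inj₁ w~y = ∈-++⁺ˡ (∈-filter⁺ (T? ∘ adj G w) (∈-allFin y) w~y)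
  ...   | inj₂ path with satisfied (any⁻ _ (allFin n) path)
  ...     | z , w~z~y with T-∧⁻ (adj G w z) w~z~y
  ...       | w~z , z~y = ∈-++⁺ʳ (neighbours w) (∈-concat⁺′ y∈ (∈-map⁺ _ (∈-filter⁺ (T? ∘ adj G w) (∈-allFin z) w~z)))
    where
    y∈ : y ∈ filterᵇ (λ y → not ⌊ y ≟ w ⌋) (neighbours z)
    y∈ = ∈-filter⁺ _ (∈-filter⁺ (T? ∘ adj G z) (∈-allFin y) z~y) (fromWitnessFalse (toWitnessFalse w≢y ∘ sym))

  module _ {d : ℕ} (deg : MaxDegreeAtMost G d) where

    length-secondNeighbours : ∀ w → length (secondNeighbours w) ≤ d * pred d
    length-secondNeighbours w = begin
      length (secondNeighbours w)  ≤⟨ length-concatMap≤ _ (neighbours w) otherNeighbours≤ ⟩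
      degree G w * pred d          ≤⟨ *-monoˡ-≤ (pred d) (deg w) ⟩
      d * pred d                   ∎
      where
      open Data.Nat.Properties.≤-Reasoning
      otherNeighbours≤ : ∀ {z} → z ∈ neighbours w → length (filterᵇ (λ y → not ⌊ y ≟ w ⌋) (neighbours z)) ≤ pred d
      otherNeighbours≤ {z} z∈ = suc[m]≤n⇒m≤pred[n] (≤-trans
        (filter-notAll _ (neighbours z) (lose w∈ (λ w≢w → toWitnessFalse w≢w refl)))
        (deg z))
        where
        w∈ : w ∈ neighbours z
        w∈ = ∈-filter⁺ (T? ∘ adj G z) (∈-allFin w) (subst T (Graph.sym G w z) (proj₂ (∈-filter⁻ (T? ∘ adj G w) {xs = allFin n} z∈)))

    sqDegree-bound : ∀ {w xs} → Unique xs → (∀ {x} → x ∈ xs → T (sqAdj G w x)) → length xs ≤ d + d * pred d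
    sqDegree-bound {w} {xs} xs! sq = begin
      length xs                                              ≤⟨ length-mono-⊆ xs! (sqAdj⇒∈ ∘ sq) ⟩
      length (neighbours w ++ secondNeighbours w)            ≡⟨ length-++ (neighbours w) ⟩
      degree G w + length (secondNeighbours w)               ≤⟨ +-mono-≤ (deg w) (length-secondNeighbours w) ⟩
      d + d * pred d                                         ∎
      where open Data.Nat.Properties.≤-Reasoning

  _⊑_ : PartialColoring G → PartialColoring G → Set
  f ⊑ g = ∀ x a → f x ≡ just a → g x ≡ just a

  ⊑-trans : ∀ {f g h} → f ⊑ g → g ⊑ h → f ⊑ h
  ⊑-trans f⊑g g⊑h x a = g⊑h x a ∘ f⊑g x a

  Colored : PartialColoring G → Fin n → Set
  Colored g x = ∃ λ a → g x ≡ just a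

  ⊑-Colored : ∀ {g h x} → g ⊑ h → Colored g x → Colored h x
  ⊑-Colored {x = x} g⊑h (a , gx) = a , g⊑h x a gx

  coloredEverywhere : ∀ {S : Fin n → Set} {f h} → Decidable S → f ⊑ h → (∀ {x} → S x → Colored h x) →
    (∀ x → f x ≡ nothing → ¬ S x → Colored h x) → ∀ x → Colored h x
  coloredEverywhere {f = f} S? f⊑h inS outsideS x with S? x | f x in fx
  ... | yes Sx | _ = inS Sx
  ... | no ¬Sx | just a = a , f⊑h x a fx
  ... | no ¬Sx | nothing = outsideS x fx ¬Sx

  ⊑-nothing : ∀ {f g x} → f ⊑ g → g x ≡ nothing → f x ≡ nothing
  ⊑-nothing {f} {g} {x} f⊑g gx with f x in fx
  ... | nothing = refl
  ... | just a with () ← trans (sym gx) (f⊑g x a fx)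

  uncoloredᵇ⇒nothing : ∀ g x → T (uncoloredᵇ G g x) → g x ≡ nothing
  uncoloredᵇ⇒nothing g x unc with g x
  ... | nothing = refl

  nothing⇒uncoloredᵇ : ∀ g x → g x ≡ nothing → T (uncoloredᵇ G g x)
  nothing⇒uncoloredᵇ g x gx with g x
  ... | nothing = _

  just⇒¬uncoloredᵇ : ∀ g x {a} → g x ≡ just a → ¬ T (uncoloredᵇ G g x)
  just⇒¬uncoloredᵇ g x gx unc with () ← trans (sym gx) (uncoloredᵇ⇒nothing g x unc)

  usedNear⁺ : ∀ g {w x k} → T (sqAdj G w x) → g x ≡ just k → T (usedNear G g w k)
  usedNear⁺ g {w} {x} {k} wx gx = any⁺ _ (lose (∈-allFin x) (Equivalence.from T-∧ (wx , isColor-k)))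
    where
    isColor-k : T (isColor G (g x) k)
    isColor-k rewrite gx = ≡⇒≡ᵇ k k refl

  usedNear⁻ : ∀ g {w k} → T (usedNear G g w k) → ∃ λ x → T (sqAdj G w x) × g x ≡ just k
  usedNear⁻ g {w} {k} used with satisfied (any⁻ _ (allFin n) used)
  ... | x , wx∧isColor with T-∧⁻ (sqAdj G w x) wx∧isColor
  ...   | wx , isColor-k = x , wx , isColor⇒≡ (g x) isColor-k
    where
    isColor⇒≡ : ∀ m → T (isColor G m k) → m ≡ just k
    isColor⇒≡ (just a) t = cong just (≡ᵇ⇒≡ a k t)

  assign : PartialColoring G → Fin n → ℕ → PartialColoring G
  assign g w k = updateAt g w (const (just k))

  ⊑-assign : ∀ {g w k} → g w ≡ nothing → g ⊑ assign g w k
  ⊑-assign {g} {w} gw x a gx = trans (updateAt-minimal x w g x≢w) gx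
    where
    x≢w : x ≢ w
    x≢w refl with () ← trans (sym gw) gx

  ∅ : PartialColoring G
  ∅ _ = nothing

  ∅⊑ : ∀ {g} → ∅ ⊑ g
  ∅⊑ _ _ ()

  uncoloredNbrList : PartialColoring G → Fin n → List (Fin n)
  uncoloredNbrList g w = filterᵇ (λ x → sqAdj G w x ∧ uncoloredᵇ G g x) (allFin n)

  newlyColoredNbrs : PartialColoring G → PartialColoring G → Fin n → List (Fin n)
  newlyColoredNbrs f g w = filterᵇ (λ x → (sqAdj G w x ∧ uncoloredᵇ G f x) ∧ not (uncoloredᵇ G g x)) (allFin n)

  uncoloredNbrs-⊑ : ∀ {f g} w → f ⊑ g →
    uncoloredNbrs G g w + length (newlyColoredNbrs f g w) ≤ uncoloredNbrs G f w
  uncoloredNbrs-⊑ {f} {g} w f⊑g = begin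
    uncoloredNbrs G g w + length (newlyColoredNbrs f g w)    ≡⟨ length-++ (uncoloredNbrList g w) ⟨
    length (uncoloredNbrList g w ++ newlyColoredNbrs f g w)  ≤⟨ length-mono-⊆ unique sub ⟩
    uncoloredNbrs G f w                                      ∎
    where
    open Data.Nat.Properties.≤-Reasoning
    U N : List (Fin n)
    U = uncoloredNbrList g w
    N = newlyColoredNbrs f g w
    inU : ∀ {x} → x ∈ U → T (sqAdj G w x) × T (uncoloredᵇ G g x)
    inU {x} x∈U = T-∧⁻ (sqAdj G w x) (proj₂ (∈-filter⁻ _ {xs = allFin n} x∈U))
    inN : ∀ {x} → x ∈ N → T (sqAdj G w x ∧ uncoloredᵇ G f x) × T (not (uncoloredᵇ G g x))
    inN {x} x∈N = T-∧⁻ (sqAdj G w x ∧ uncoloredᵇ G f x) (proj₂ (∈-filter⁻ _ {xs = allFin n} x∈N))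
    disjoint : Disjoint U N
    disjoint (x∈U , x∈N) = T-not⇒¬T (proj₂ (inN x∈N)) (proj₂ (inU x∈U))
    unique : Unique (U ++ N)
    unique = Unique.++⁺ (Unique.filter⁺ _ (Unique.allFin⁺ n)) (Unique.filter⁺ _ (Unique.allFin⁺ n)) disjoint
    sub : U ++ N ⊆ uncoloredNbrList f w
    sub {x} x∈U++N = ∈-filter⁺ _ (∈-allFin x) (inUncoloredNbrs (∈-++⁻ U x∈U++N))
      where
      inUncoloredNbrs : x ∈ U ⊎ x ∈ N → T (sqAdj G w x ∧ uncoloredᵇ G f x)
      inUncoloredNbrs (inj₁ x∈U) = let (wx , unc) = inU x∈U in
        Equivalence.from T-∧ (wx , nothing⇒uncoloredᵇ f x (⊑-nothing f⊑g (uncoloredᵇ⇒nothing g x unc)))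
      inUncoloredNbrs (inj₂ x∈N) = proj₁ (inN x∈N)

  TwoLaterNbrs : (Fin n → Set) → List (Fin n) → Set
  TwoLaterNbrs P ys = ∀ xs y zs → ys ≡ xs ++ y ∷ zs → ¬ P y → 2 ≤ length (filterᵇ (sqAdj G y) zs)

  TwoLaterNbrs-tail : ∀ {P y ys} → TwoLaterNbrs P (y ∷ ys) → TwoLaterNbrs P ys
  TwoLaterNbrs-tail {y = y} later xs z zs ys≡ = later (y ∷ xs) z zs (cong (y ∷_) ys≡)

  module ListColoring (L : Fin n → List ℕ) where

    availableColors : PartialColoring G → Fin n → List ℕ
    availableColors g w = filterᵇ (λ k → not (usedNear G g w k)) (L w)

    available-⊑ : ∀ {f g} w → f ⊑ g → Unique (L w) →
      available G L f w ≤ available G L g w + length (newlyColoredNbrs f g w)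
    available-⊑ {f} {g} w f⊑g L! = begin
      available G L f w                                          ≤⟨ length-mono-⊆ (Unique.filter⁺ _ L!) sub ⟩
      length (availableColors g w ++ map colour N)               ≡⟨ length-++ (availableColors g w) ⟩
      available G L g w + length (map colour N)                  ≡⟨ cong (_+_ (available G L g w)) (length-map colour N) ⟩
      available G L g w + length N                               ∎
      where
      open Data.Nat.Properties.≤-Reasoning
      N : List (Fin n)
      N = newlyColoredNbrs f g w
      -- the default 0 is never used: every vertex of N is coloured in g
      colour : Fin n → ℕ
      colour x = fromMaybe 0 (g x)
      sub : availableColors f w ⊆ availableColors g w ++ map colour N
      sub {k} k∈ with ∈-filter⁻ _ {xs = L w} k∈ | T? (usedNear G g w k)
      ... | k∈L , free | no unused = ∈-++⁺ˡ (∈-filter⁺ _ k∈L (¬T⇒T-not unused))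
      ... | k∈L , free | yes used with usedNear⁻ g used
      ...   | x , wx , gx with f x in fx
      ...     | just a with refl ← trans (sym (f⊑g x a fx)) gx = ⊥-elim (T-not⇒¬T free (usedNear⁺ f wx fx))
      ...     | nothing = ∈-++⁺ʳ (availableColors g w) (subst (_∈ map colour N) (cong (fromMaybe 0) gx)
                  (∈-map⁺ colour (∈-filter⁺ _ (∈-allFin x) x∈N)))
        where
        x∈N : T ((sqAdj G w x ∧ uncoloredᵇ G f x) ∧ not (uncoloredᵇ G g x))
        x∈N = Equivalence.from T-∧ (Equivalence.from T-∧ (wx , nothing⇒uncoloredᵇ f x fx) , ¬T⇒T-not (just⇒¬uncoloredᵇ g x gx))

    ExcessAtLeast : PartialColoring G → Fin n → ℕ → Set
    ExcessAtLeast g w k = k + uncoloredNbrs G g w ≤ suc (available G L g w)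

    excess≥⇒ExcessAtLeast : ∀ {g w k} → + k ≤ℤ excess G L g w → ExcessAtLeast g w k
    excess≥⇒ExcessAtLeast {g} {w} {k} k≤excess = ℤP.drop‿+≤+ (begin
      + (k + c)              ≡⟨ ℤP.pos-+ k c ⟩
      + k ℤ.+ + c            ≤⟨ ℤP.+-monoˡ-≤ (+ c) k≤excess ⟩
      excess G L g w ℤ.+ + c ≡⟨ //-rightDividesˡ (+ c) (+ suc (available G L g w)) ⟩
      + suc (available G L g w) ∎)
      where
      open ℤP.≤-Reasoning
      c : ℕ
      c = uncoloredNbrs G g w

    ExcessAtLeast-⊑ : ∀ {f g w k} → f ⊑ g → Unique (L w) → ExcessAtLeast f w k → ExcessAtLeast g w k
    ExcessAtLeast-⊑ {f} {g} {w} {k} f⊑g L! excess-f = +-cancelʳ-≤ N _ _ (begin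
      k + uncoloredNbrs G g w + N       ≡⟨ +-assoc k _ N ⟩
      k + (uncoloredNbrs G g w + N)     ≤⟨ +-monoʳ-≤ k (uncoloredNbrs-⊑ w f⊑g) ⟩
      k + uncoloredNbrs G f w           ≤⟨ excess-f ⟩
      suc (available G L f w)           ≤⟨ s≤s (available-⊑ w f⊑g L!) ⟩
      suc (available G L g w + N)       ∎)
      where
      open Data.Nat.Properties.≤-Reasoning
      N : ℕ
      N = length (newlyColoredNbrs f g w)

    available-∅ : ∀ w → available G L ∅ w ≡ length (L w)
    available-∅ w = cong length (filter-all (T? ∘ _) (All.universal (λ k → ¬T⇒T-not (unused k)) (L w)))
      where
      unused : ∀ k → ¬ T (usedNear G ∅ w k)
      unused k used with usedNear⁻ ∅ {w} {k} used
      ... | _ , _ , ()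

    ExcessAtLeast-∅ : ∀ {d} → MaxDegreeAtMost G d → ∀ {w} → d + d * pred d ≤ suc (length (L w)) → ExcessAtLeast ∅ w 0
    ExcessAtLeast-∅ {d} deg {w} enoughColors = begin
      uncoloredNbrs G ∅ w        ≤⟨ sqDegree-bound deg (Unique.filter⁺ _ (Unique.allFin⁺ n)) sqAdjacent ⟩
      d + d * pred d             ≤⟨ enoughColors ⟩
      suc (length (L w))         ≡⟨ cong suc (available-∅ w) ⟨
      suc (available G L ∅ w)    ∎
      where
      open Data.Nat.Properties.≤-Reasoning
      sqAdjacent : ∀ {x} → x ∈ uncoloredNbrList ∅ w → T (sqAdj G w x)
      sqAdjacent {x} x∈ = proj₁ (T-∧⁻ (sqAdj G w x) (proj₂ (∈-filter⁻ _ {xs = allFin n} x∈)))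

    assign-proper : ∀ {g w c} → IsPartialProperColoring G L g → c ∈ L w → T (not (usedNear G g w c)) →
      IsPartialProperColoring G L (assign g w c)
    assign-proper {g} {w} {c} (inLists , distinct) c∈L free = inLists′ , distinct′
      where
      assigned : ∀ {a} → assign g w c w ≡ just a → c ≡ a
      assigned = just-injective ∘ trans (sym (updateAt-updates w g))
      kept : ∀ {x a} → x ≢ w → assign g w c x ≡ just a → g x ≡ just a
      kept {x} x≢w = trans (sym (updateAt-minimal x w g x≢w))
      clash : ∀ {x a} → T (sqAdj G w x) → x ≢ w → assign g w c w ≡ just a → assign g w c x ≡ just a → ⊥
      clash wx x≢w gw gx with refl ← assigned gw = T-not⇒¬T free (usedNear⁺ g wx (kept x≢w gx))
      inLists′ : ∀ x a → assign g w c x ≡ just a → a ∈ L x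
      inLists′ x a gx with x ≟ w
      ... | yes refl with refl ← assigned gx = c∈L
      ... | no x≢w = inLists x a (kept x≢w gx)
      distinct′ : ∀ x y a → sqAdj G x y ≡ true → assign g w c x ≡ just a → assign g w c y ≡ just a → ⊥
      distinct′ x y a xy gx gy with x ≟ w | y ≟ w
      ... | yes refl | yes refl = sqAdj⇒≢ (Equivalence.from T-≡ xy) refl
      ... | yes refl | no y≢w = clash (Equivalence.from T-≡ xy) y≢w gx gy
      ... | no x≢w | yes refl = clash (Equivalence.from T-≡ (trans (sqAdj-sym y x) xy)) x≢w gy gx
      ... | no x≢w | no y≢w = distinct x y a xy (kept x≢w gx) (kept y≢w gy)

    colorVertex : ∀ {g w k} → IsPartialProperColoring G L g → ExcessAtLeast g w k →
      2 ≤ k + uncoloredNbrs G g w → ∃ λ c → IsPartialProperColoring G L (assign g w c)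
    colorVertex {g} {w} proper excess two with nonEmpty⇒∈ (suc[m]≤n⇒m≤pred[n] (≤-trans two excess))
    ... | c , c∈ with ∈-filter⁻ _ {xs = L w} c∈
    ...   | c∈L , free = c , assign-proper proper c∈L free

    record Extension (P : Fin n → Set) (g : PartialColoring G) (ys : List (Fin n)) : Set where
      field
        coloring : PartialColoring G
        proper   : IsPartialProperColoring G L coloring
        extends  : g ⊑ coloring
        fixes    : ∀ x → P x → coloring x ≡ g x
        colors   : ∀ {y} → y ∈ ys → ¬ P y → Colored coloring y

    module Greedy (L! : ∀ w → Unique (L w)) (excess₀ : ∀ w → ExcessAtLeast ∅ w 0) where

      greedy : ∀ {P} → Decidable P → ∀ {g} ys → IsPartialProperColoring G L g → Unique ys →
        All (λ y → g y ≡ nothing) ys → TwoLaterNbrs P ys → Extension P g ys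
      greedy P? {g} [] proper _ _ _ = record
        { coloring = g ; proper = proper ; extends = λ _ _ gx → gx ; fixes = λ _ _ → refl ; colors = λ () }
      greedy {P} P? {g} (y ∷ ys) g-proper (y∉ys ∷ ys!) (gy ∷ ys-uncolored) later with P? y
      ... | yes Py = record { Extension rest ; colors = colors }
        where
        rest : Extension P g ys
        rest = greedy P? ys g-proper ys! ys-uncolored (TwoLaterNbrs-tail later)
        colors : ∀ {x} → x ∈ y ∷ ys → ¬ P x → Colored (Extension.coloring rest) x
        colors (here refl) ¬Py = ⊥-elim (¬Py Py)
        colors (there x∈ys) = Extension.colors rest x∈ys
      ... | no ¬Py = record
        { coloring = coloring
        ; proper = proper
        ; extends = ⊑-trans (⊑-assign gy) extends
        ; fixes = λ x Px → trans (fixes x Px) (updateAt-minimal x y g (λ { refl → ¬Py Px }))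
        ; colors = λ { (here refl) _ → c , extends y c (updateAt-updates y g) ; (there x∈ys) → colors x∈ys }
        }
        where
        uncoloredLater : filterᵇ (sqAdj G y) ys ⊆ uncoloredNbrList g y
        uncoloredLater {x} x∈ with ∈-filter⁻ _ {xs = ys} x∈
        ... | x∈ys , yx = ∈-filter⁺ _ (∈-allFin x)
          (Equivalence.from T-∧ (yx , nothing⇒uncoloredᵇ g x (All.lookup ys-uncolored x∈ys)))
        colorable : ∃ λ c → IsPartialProperColoring G L (assign g y c)
        colorable = colorVertex g-proper (ExcessAtLeast-⊑ ∅⊑ (L! y) (excess₀ y))
          (≤-trans (later [] y ys refl ¬Py) (length-mono-⊆ (Unique.filter⁺ _ ys!) uncoloredLater))
        c : ℕ
        c = proj₁ colorable
        ys-uncolored′ : All (λ x → assign g y c x ≡ nothing) ys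
        ys-uncolored′ = All.tabulate λ {x} x∈ys →
          trans (updateAt-minimal x y g (λ x≡y → All.lookup y∉ys x∈ys (sym x≡y))) (All.lookup ys-uncolored x∈ys)
        open Extension (greedy P? ys (proj₂ colorable) ys! ys-uncolored′ (TwoLaterNbrs-tail later))

      colorPair : ∀ {f h u v} → IsPartialProperColoring G L h → f ⊑ h → h u ≡ nothing → h v ≡ nothing →
        T (sqAdj G u v) → ExcessAtLeast f u 1 → ExcessAtLeast f v 2 → Extension (λ _ → ⊥) h (u ∷ v ∷ [])
      colorPair {f} {h} {u} {v} h-proper f⊑h hu hv uv excess-u excess-v = record
        { coloring = h₂
        ; proper = proj₂ colorable-v
        ; extends = ⊑-trans h⊑h₁ (⊑-assign h₁v)
        ; fixes = λ _ ()
        ; colors = λ { (here refl) _ → a , ⊑-assign h₁v u a (updateAt-updates u h)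
                     ; (there (here refl)) _ → b , updateAt-updates v h₁ }
        }
        where
        v-uncoloredNbr : 0 < uncoloredNbrs G h u
        v-uncoloredNbr = filter-some _ (lose (∈-allFin v) (Equivalence.from T-∧ (uv , nothing⇒uncoloredᵇ h v hv)))
        colorable-u : ∃ λ a → IsPartialProperColoring G L (assign h u a)
        colorable-u = colorVertex h-proper (ExcessAtLeast-⊑ f⊑h (L! u) excess-u) (s≤s v-uncoloredNbr)
        a : ℕ
        a = proj₁ colorable-u
        h₁ : PartialColoring G
        h₁ = assign h u a
        h⊑h₁ : h ⊑ h₁
        h⊑h₁ = ⊑-assign hu
        h₁v : h₁ v ≡ nothing
        h₁v = trans (updateAt-minimal v u h (sqAdj⇒≢ uv ∘ sym)) hv
        colorable-v : ∃ λ b → IsPartialProperColoring G L (assign h₁ v b)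
        colorable-v = colorVertex (proj₂ colorable-u) (ExcessAtLeast-⊑ (⊑-trans f⊑h h⊑h₁) (L! v) excess-v) (m≤m+n 2 _)
        b : ℕ
        b = proj₁ colorable-v
        h₂ : PartialColoring G
        h₂ = assign h₁ v b

    total⇒proper : ∀ {g} → IsPartialProperColoring G L g → (∀ x → Colored g x) →
      ∃ λ c → IsProperColoring G L c × (∀ x → g x ≡ just (c x))
    total⇒proper {g} (inLists , distinct) colored =
      c , ((λ x → inLists x (c x) (gx x)) , λ x y xy cx≡cy → distinct x y (c x) xy (gx x) (trans (gx y) (cong just (sym cx≡cy)))) , gx
      where
      c : Fin n → ℕ
      c = proj₁ ∘ colored
      gx : ∀ x → g x ≡ just (c x)
      gx = proj₂ ∘ colored

lemma4 : ∀ {n : ℕ} (G : Graph n) (L : Fin n → List ℕ) (f : PartialColoring G) (u v : Fin n)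
  → MaxDegreeAtMost G 3
  → (∀ w → length (L w) ≡ 8 × Unique (L w))
  → IsPartialProperColoring G L f
  → f u ≡ nothing → f v ≡ nothing → sqAdj G u v ≡ true
  → + 1 ≤ℤ excess G L f u → + 2 ≤ℤ excess G L f v
  → (σ : List (Fin n)) → IsOrderingOfUncolored G f σ
  → (∀ xs w ys → σ ≡ xs ++ (w ∷ ys) → w ≢ u → w ≢ v
       → 2 ≤ length (filterᵇ (sqAdj G w) ys))
  → Σ (Fin n → ℕ) (λ c → IsProperColoring G L c × (∀ w a → f w ≡ just a → c w ≡ a))
lemma4 G L f u v deg L8 f-proper fu fv uv excess-u excess-v σ (σ! , σ-uncolored) later =
  let (c , c-proper , hc) = total⇒proper h-proper colored
  in c , c-proper , λ x a fx → just-injective (trans (sym (hc x)) (⊑-trans extends h₀⊑h x a fx))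
  where
  open PartialColorings G
  open ListColoring L
  L! : ∀ w → Unique (L w)
  L! = proj₂ ∘ L8
  excess₀ : ∀ w → ExcessAtLeast ∅ w 0
  excess₀ w = ExcessAtLeast-∅ deg (≤-reflexive (cong suc (sym (proj₁ (L8 w)))))
  open Greedy L! excess₀
  E₀ : Extension (λ x → x ≡ u ⊎ x ≡ v) f σ
  E₀ = greedy (λ x → x ≟ u ⊎-dec x ≟ v) σ f-proper σ! (All.tabulate (proj₁ (σ-uncolored _)))
    (λ xs w ys σ≡ ¬uv → later xs w ys σ≡ (¬uv ∘ inj₁) (¬uv ∘ inj₂))
  open Extension E₀ renaming (coloring to h₀; proper to h₀-proper)
  E₁ : Extension (λ _ → ⊥) h₀ (u ∷ v ∷ [])
  E₁ = colorPair h₀-proper extends (trans (fixes u (inj₁ refl)) fu) (trans (fixes v (inj₂ refl)) fv)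
    (Equivalence.from T-≡ uv) (excess≥⇒ExcessAtLeast excess-u) (excess≥⇒ExcessAtLeast excess-v)
  open Extension E₁ using () renaming (coloring to h; proper to h-proper; extends to h₀⊑h; colors to colors-uv)
  colored : ∀ x → Colored h x
  colored = coloredEverywhere (λ x → x ≟ u ⊎-dec x ≟ v) (⊑-trans extends h₀⊑h)
    [ (λ { refl → colors-uv (here refl) λ () }) , (λ { refl → colors-uv (there (here refl)) λ () }) ]
    (λ x fx ¬uv → ⊑-Colored h₀⊑h (colors (proj₂ (σ-uncolored x) fx) ¬uv))
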